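{- Let $n\ge 1$ and $m$ be integers. If $n\le 3m+5$ and $n\equiv m+1 \pmod 2$, then \[ N^{0}(m,n)=p\!\left(\tfrac{n-m-1}{2}\right). \]
   Context: An odd Durfee symbol of a positive integer $n$ consists of a nonnegative integer $D$ together with two (possibly empty) non-increasing sequences of odd positive integers $a_1\ge\cdots\ge a_s$ (top row) and $b_1\ge\cdots\ge b_t$ (bottom row), all entries at most $2D+1$, such that $n=\sum a_i+\sum b_j+2D^2+2D+1$. Its odd rank is $s-t$. $N^{0}(m,n)$ is the number of odd Durfee symbols of $n$ with odd rank $m$. $p(k)$ is the number of partitions of $k$, with $p(0)=1$ and $p(k)=0$ for $k<0$. -}

module Defs where

open import Data.Nat as ℕ using (ℕ; zero; suc; _+_; _*_; _∸_; _≤?_)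
open import Data.Nat.Base using (_≡ᵇ_)
open import Data.Bool using (Bool; true; false; _∧_; if_then_else_)
open import Data.List using (List; []; _∷_; map; concatMap; filterᵇ; length; upTo; sum)
open import Data.Product using (_×_; _,_)
open import Data.Integer as ℤ using (ℤ; +_; -[1+_])
open import Relation.Nullary.Decidable using (⌊_⌋)

range1 : ℕ → List ℕ
range1 k = map suc (upTo k)

oddᵇ : ℕ → Bool
oddᵇ a = (a ℕ.% 2) ≡ᵇ 1

-- All non-increasing lists (a₁ ≥ a₂ ≥ ⋯) with entries in [1, bound]
-- satisfying the Boolean filter `ok`, whose entries sum to exactly r.
-- `fuel` bounds the length; fuel = r suffices since every entry is ≥ 1.
nonIncSeqs : (ℕ → Bool) → (fuel bound r : ℕ) → List (List ℕ)
nonIncSeqs ok fuel       bound zero    = [] ∷ []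
nonIncSeqs ok zero       bound (suc r) = []
nonIncSeqs ok (suc fuel) bound (suc r) =
  concatMap (λ a → map (a ∷_) (nonIncSeqs ok fuel a (suc r ∸ a)))
            (filterᵇ (λ a → ok a ∧ ⌊ a ≤? suc r ⌋) (range1 bound))

partitions : ℕ → List (List ℕ)
partitions k = nonIncSeqs (λ _ → true) k k k

p : ℕ → ℕ
p k = length (partitions k)

pℤ : ℤ → ℕ
pℤ (+ k)    = p k
pℤ -[1+ _ ] = 0

-- An odd Durfee symbol: (D, top row, bottom row).
OddDurfeeSymbol : Set
OddDurfeeSymbol = ℕ × List ℕ × List ℕ

oddRows : (D r : ℕ) → List (List ℕ)
oddRows D r = nonIncSeqs oddᵇ r (2 * D + 1) r

-- All odd Durfee symbols of n:
--   n = Σ aᵢ + Σ bⱼ + 2D² + 2D + 1, with top / bottom rows as above.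
-- D ranges over 0..n (since 2D²+2D+1 ≤ n forces D < n), the top-row sum
-- over 0..n, and the bottom-row sum is whatever remains.
oddDurfeeSymbols : ℕ → List OddDurfeeSymbol
oddDurfeeSymbols n =
  concatMap (λ D →
    concatMap (λ j →
      let rest = n ∸ (2 * D * D + 2 * D + 1) in
      if ⌊ (2 * D * D + 2 * D + 1 + j) ≤? n ⌋
      then concatMap (λ top → map (λ bot → (D , top , bot))
                                  (oddRows D (rest ∸ j)))
                     (oddRows D j)
      else [])
    (upTo (suc n)))
  (upTo (suc n))

oddRank : OddDurfeeSymbol → ℤ
oddRank (D , top , bot) = (+ length top) ℤ.- (+ length bot)

N⁰ : ℤ → ℕ → ℕ
N⁰ m n = length (filterᵇ (λ s → ⌊ oddRank s ℤ.≟ m ⌋) (oddDurfeeSymbols n))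

-- For m ≥ 0 an odd Durfee symbol with parameter D and odd rank m is a pair of rows of odd
-- parts ≤ 2D + 1 whose top row has m more parts than its bottom row.  Replacing every part
-- 2a + 1 of the bottom row by a + 1 gives a partition with parts ≤ D + 1; subtracting 1 from
-- every part of the top row and halving gives a partition with parts ≤ D, and it has at most
-- as many parts as the top row because n ≤ 3m + 5 keeps the top weight at most three times
-- its length.  Hence for n = 2k + m + 1 the symbols with parameter D are counted by the
-- coefficient of q^(k - D(D+1)) in P_D P_(D+1), where P_b generates the partitions with
-- parts ≤ b, and summing over D gives p(k) by the Durfee rectangle identity
--   P_(c+e) = Σ_D q^(D(D+c)) [D × (e - D) box] P_(D+c),
-- proved by induction on e.  For n ≤ m both sides vanish.

module Submission where

open import Defs

module Counting where

  open import Data.Bool using (Bool; true; false; _∧_; if_then_else_; T)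
  open import Data.Empty using (⊥-elim)
  import Data.Integer as ℤ
  open import Data.Integer using (-[1+_])
  import Data.Integer.DivMod as ℤDM
  import Data.Integer.Properties as ℤP
  open import Data.Integer.Tactic.RingSolver using () renaming (solve-∀ to solveℤ-∀)
  open import Data.List using (List; []; _∷_; map; concatMap; filterᵇ; length; upTo; applyUpTo; _++_)
  open import Data.List.Properties using (map-++; map-∘; map-cong; concatMap-cong)
  open import Data.Nat
  open import Data.Nat.DivMod using ([m+n]%n≡m%n; m*n/n≡m)
  open import Data.Nat.Divisibility using (_∣_; divides)
  open import Data.Nat.ListAction using (sum)
  open import Data.Nat.ListAction.Properties using (sum-++)
  open import Data.Nat.Properties
  open import Data.Nat.Tactic.RingSolver using (solve-∀)
  open import Data.Product using (_,_)
  open import Data.Sum as Sum using (_⊎_; inj₁; inj₂)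
  open import Function using (_∘_; id)
  open import Relation.Binary.PropositionalEquality
  open import Relation.Nullary using (Dec; yes; no; ¬_)
  open import Relation.Nullary.Decidable using (⌊_⌋)
  open import Algebra.Properties.CommutativeSemigroup +-commutativeSemigroup
    using () renaming (interchange to +-interchange)
  open ≡-Reasoning

  ∑< : ℕ → (ℕ → ℕ) → ℕ
  ∑< zero    f = 0
  ∑< (suc n) f = f 0 + ∑< n (f ∘ suc)

  syntax ∑< n (λ i → e) = ∑[ i < n ] e

  ∑-cong-< : ∀ n {f g : ℕ → ℕ} → (∀ i → i < n → f i ≡ g i) → ∑< n f ≡ ∑< n g
  ∑-cong-< zero    eq = refl
  ∑-cong-< (suc n) eq = cong₂ _+_ (eq 0 z<s) (∑-cong-< n (λ i i<n → eq (suc i) (s<s i<n)))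

  ∑-cong : ∀ n {f g : ℕ → ℕ} → (∀ i → f i ≡ g i) → ∑< n f ≡ ∑< n g
  ∑-cong n eq = ∑-cong-< n (λ i _ → eq i)

  ∑-zero : ∀ n {f : ℕ → ℕ} → (∀ i → i < n → f i ≡ 0) → ∑< n f ≡ 0
  ∑-zero zero    vanish = refl
  ∑-zero (suc n) vanish = cong₂ _+_ (vanish 0 z<s) (∑-zero n (λ i i<n → vanish (suc i) (s<s i<n)))

  ∑-last : ∀ n (f : ℕ → ℕ) → ∑< (suc n) f ≡ ∑< n f + f n
  ∑-last zero    f = +-comm (f 0) 0
  ∑-last (suc n) f = begin
    f 0 + ∑< (suc n) (f ∘ suc)       ≡⟨ cong (f 0 +_) (∑-last n (f ∘ suc)) ⟩
    f 0 + (∑< n (f ∘ suc) + f (suc n)) ≡⟨ +-assoc (f 0) _ _ ⟨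
    f 0 + ∑< n (f ∘ suc) + f (suc n) ∎

  ∑-distrib-+ : ∀ n (f g : ℕ → ℕ) → ∑[ i < n ] (f i + g i) ≡ ∑< n f + ∑< n g
  ∑-distrib-+ zero    f g = refl
  ∑-distrib-+ (suc n) f g = begin
    f 0 + g 0 + ∑[ i < n ] (f (suc i) + g (suc i))
      ≡⟨ cong (f 0 + g 0 +_) (∑-distrib-+ n (f ∘ suc) (g ∘ suc)) ⟩
    f 0 + g 0 + (∑< n (f ∘ suc) + ∑< n (g ∘ suc))
      ≡⟨ +-interchange (f 0) (g 0) _ _ ⟩
    f 0 + ∑< n (f ∘ suc) + (g 0 + ∑< n (g ∘ suc)) ∎

  ∑-distribʳ-* : ∀ n (f : ℕ → ℕ) c → ∑[ i < n ] (f i * c) ≡ ∑< n f * c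
  ∑-distribʳ-* zero    f c = refl
  ∑-distribʳ-* (suc n) f c =
    trans (cong (f 0 * c +_) (∑-distribʳ-* n (f ∘ suc) c)) (sym (*-distribʳ-+ c (f 0) _))

  ∑-comm : ∀ m n (f : ℕ → ℕ → ℕ) → ∑[ i < m ] ∑[ j < n ] f i j ≡ ∑[ j < n ] ∑[ i < m ] f i j
  ∑-comm zero    n f = sym (∑-zero n (λ _ _ → refl))
  ∑-comm (suc m) n f = begin
    ∑< n (f 0) + ∑[ i < m ] ∑[ j < n ] f (suc i) j ≡⟨ cong (∑< n (f 0) +_) (∑-comm m n (f ∘ suc)) ⟩
    ∑< n (f 0) + ∑[ j < n ] ∑[ i < m ] f (suc i) j ≡⟨ ∑-distrib-+ n (f 0) _ ⟨
    ∑[ j < n ] (f 0 j + ∑[ i < m ] f (suc i) j)   ∎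

  ∑-truncate : ∀ k n (f : ℕ → ℕ) → k ≤ n → (∀ i → k ≤ i → i < n → f i ≡ 0) → ∑< n f ≡ ∑< k f
  ∑-truncate k zero    f z≤n vanish = refl
  ∑-truncate k (suc n) f k≤1+n vanish with k ≟ suc n
  ... | yes refl = refl
  ... | no k≢1+n = begin
    ∑< (suc n) f  ≡⟨ ∑-last n f ⟩
    ∑< n f + f n  ≡⟨ cong (∑< n f +_) (vanish n k≤n ≤-refl) ⟩
    ∑< n f + 0    ≡⟨ +-identityʳ _ ⟩
    ∑< n f        ≡⟨ ∑-truncate k n f k≤n (λ i k≤i i<n → vanish i k≤i (m≤n⇒m≤1+n i<n)) ⟩
    ∑< k f        ∎
    where k≤n = ≤-pred (≤∧≢⇒< k≤1+n k≢1+n)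

  ∑-reverse : ∀ n (f : ℕ → ℕ) → ∑< n f ≡ ∑[ i < n ] f (n ∸ suc i)
  ∑-reverse zero    f = refl
  ∑-reverse (suc n) f = begin
    ∑< (suc n) f  ≡⟨ ∑-last n f ⟩
    ∑< n f + f n  ≡⟨ +-comm _ (f n) ⟩
    f n + ∑< n f  ≡⟨ cong (f n +_) (∑-reverse n f) ⟩
    f n + ∑[ i < n ] f (n ∸ suc i) ∎

  -- Power series in q, as coefficient sequences

  -- q^d · f
  shift : ℕ → (ℕ → ℕ) → ℕ → ℕ
  shift zero    f x       = f x
  shift (suc d) f zero    = 0
  shift (suc d) f (suc x) = shift d f x

  shift-at : ∀ d f y → shift d f (d + y) ≡ f y
  shift-at zero    f y = refl
  shift-at (suc d) f y = shift-at d f y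

  shift-below : ∀ d f x → x < d → shift d f x ≡ 0
  shift-below (suc d) f zero    _         = refl
  shift-below (suc d) f (suc x) (s<s x<d) = shift-below d f x x<d

  shift-≥ : ∀ d f {x} → d ≤ x → shift d f x ≡ f (x ∸ d)
  shift-≥ d f {x} d≤x = begin
    shift d f x             ≡⟨ cong (shift d f) (m+[n∸m]≡n d≤x) ⟨
    shift d f (d + (x ∸ d)) ≡⟨ shift-at d f (x ∸ d) ⟩
    f (x ∸ d)               ∎

  shift-cong : ∀ d {f g} x → (∀ y → d + y ≡ x → f y ≡ g y) → shift d f x ≡ shift d g x
  shift-cong zero    x       eq = eq x refl
  shift-cong (suc d) zero    eq = refl
  shift-cong (suc d) (suc x) eq = shift-cong d x (λ y e → eq y (cong suc e))

  shift-shift : ∀ a b f x → shift a (shift b f) x ≡ shift (a + b) f x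
  shift-shift zero    b f x       = refl
  shift-shift (suc a) b f zero    = refl
  shift-shift (suc a) b f (suc x) = shift-shift a b f x

  shift-comm : ∀ a b f x → shift a (shift b f) x ≡ shift b (shift a f) x
  shift-comm a b f x = begin
    shift a (shift b f) x ≡⟨ shift-shift a b f x ⟩
    shift (a + b) f x     ≡⟨ cong (λ k → shift k f x) (+-comm a b) ⟩
    shift (b + a) f x     ≡⟨ shift-shift b a f x ⟨
    shift b (shift a f) x ∎

  shift-+ : ∀ d f g x → shift d (λ y → f y + g y) x ≡ shift d f x + shift d g x
  shift-+ zero    f g x       = refl
  shift-+ (suc d) f g zero    = refl
  shift-+ (suc d) f g (suc x) = shift-+ d f g x

  shift-∑ : ∀ d n (F : ℕ → ℕ → ℕ) x → shift d (λ y → ∑[ i < n ] F i y) x ≡ ∑[ i < n ] shift d (F i) x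
  shift-∑ zero    n F x       = refl
  shift-∑ (suc d) n F zero    = sym (∑-zero n (λ _ _ → refl))
  shift-∑ (suc d) n F (suc x) = shift-∑ d n F x

  shift-*ʳ : ∀ d (f g : ℕ → ℕ) x → shift d f x * g x ≡ shift d (λ y → f y * g (d + y)) x
  shift-*ʳ zero    f g x       = refl
  shift-*ʳ (suc d) f g zero    = refl
  shift-*ʳ (suc d) f g (suc x) = shift-*ʳ d f (g ∘ suc) x

  shift-+-at : ∀ j a (f : ℕ → ℕ) t → shift (j + a) f (j + t) ≡ shift a f t
  shift-+-at zero    a f t = refl
  shift-+-at (suc j) a f t = shift-+-at j a f t

  shift-∸ : ∀ a j R (f : ℕ → ℕ) → j ≤ R → shift a f (R ∸ j) ≡ shift (j + a) f R
  shift-∸ a j R f j≤R = trans (sym (shift-+-at j a f (R ∸ j))) (cong (shift (j + a) f) (m+[n∸m]≡n j≤R))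

  ∑-shift : ∀ d n (f : ℕ → ℕ) → ∑< n (shift d f) ≡ ∑< (n ∸ d) f
  ∑-shift zero    n       f = refl
  ∑-shift (suc d) zero    f = refl
  ∑-shift (suc d) (suc n) f = ∑-shift d n f

  guarded-shift : ∀ d x (h f : ℕ → ℕ) → (∀ y → d + y ≡ x → h x ≡ f y) →
                  (if ⌊ d ≤? x ⌋ then h x else 0) ≡ shift d f x
  guarded-shift d x h f eq with d ≤? x
  ... | yes d≤x = trans (eq (x ∸ d) (m+[n∸m]≡n d≤x)) (sym (shift-≥ d f d≤x))
  ... | no  d≰x = sym (shift-below d f x (≰⇒> d≰x))

  -- f(q²)
  spread : (ℕ → ℕ) → ℕ → ℕ
  spread f zero          = f 0
  spread f (suc zero)    = 0
  spread f (suc (suc z)) = spread (f ∘ suc) z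

  spread-cong : ∀ z {f g : ℕ → ℕ} → (∀ x → f x ≡ g x) → spread f z ≡ spread g z
  spread-cong zero          eq = eq 0
  spread-cong (suc zero)    eq = refl
  spread-cong (suc (suc z)) eq = spread-cong z (eq ∘ suc)

  spread-double : ∀ x (f : ℕ → ℕ) → spread f (x + x) ≡ f x
  spread-double zero    f = refl
  spread-double (suc x) f = trans (cong (spread f ∘ suc) (+-suc x x)) (spread-double x (f ∘ suc))

  spread-zero : ∀ z (f : ℕ → ℕ) → (∀ x → f x ≡ 0) → spread f z ≡ 0
  spread-zero zero          f vanish = vanish 0
  spread-zero (suc zero)    f vanish = refl
  spread-zero (suc (suc z)) f vanish = spread-zero z (f ∘ suc) (vanish ∘ suc)

  spread-shift : ∀ d (f : ℕ → ℕ) z → spread (shift d f) z ≡ shift (d + d) (spread f) z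
  spread-shift zero    f z             = refl
  spread-shift (suc d) f zero          = refl
  spread-shift (suc d) f (suc zero)    =
    sym (shift-below (d + suc d) (spread f) 0 (subst (0 <_) (sym (+-suc d d)) z<s))
  spread-shift (suc d) f (suc (suc z)) = begin
    spread (shift d f) z                 ≡⟨ spread-shift d f z ⟩
    shift (suc (d + d)) (spread f) (suc z) ≡⟨ cong (λ k → shift k (spread f) (suc z)) (+-suc d d) ⟨
    shift (d + suc d) (spread f) (suc z) ∎

  spread-∑ : ∀ n (F : ℕ → ℕ → ℕ) z → spread (λ x → ∑[ i < n ] F i x) z ≡ ∑[ i < n ] spread (F i) z
  spread-∑ n F zero          = refl
  spread-∑ n F (suc zero)    = sym (∑-zero n (λ _ _ → refl))
  spread-∑ n F (suc (suc z)) = spread-∑ n (λ i x → F i (suc x)) z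

  δ : ℕ → ℕ
  δ zero    = 1
  δ (suc _) = 0

  infixl 7 _⋆_
  _⋆_ : (ℕ → ℕ) → (ℕ → ℕ) → ℕ → ℕ
  (f ⋆ g) r = ∑[ i < suc r ] (f i * g (r ∸ i))

  δ-⋆ : ∀ (g : ℕ → ℕ) r → (δ ⋆ g) r ≡ g r
  δ-⋆ g r = trans (cong (g r + 0 +_) (∑-zero r (λ _ _ → refl))) (trans (+-identityʳ _) (+-identityʳ _))

  ⋆-congˡ : ∀ r {f f' : ℕ → ℕ} (g : ℕ → ℕ) → (∀ i → i ≤ r → f i ≡ f' i) → (f ⋆ g) r ≡ (f' ⋆ g) r
  ⋆-congˡ r g eq = ∑-cong-< (suc r) (λ i i<1+r → cong (_* g (r ∸ i)) (eq i (≤-pred i<1+r)))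

  ⋆-distribʳ-+ : ∀ (f f' g : ℕ → ℕ) r → ((λ x → f x + f' x) ⋆ g) r ≡ (f ⋆ g) r + (f' ⋆ g) r
  ⋆-distribʳ-+ f f' g r = trans (∑-cong (suc r) (λ i → *-distribʳ-+ (g (r ∸ i)) (f i) (f' i)))
                                (∑-distrib-+ (suc r) (λ i → f i * g (r ∸ i)) (λ i → f' i * g (r ∸ i)))

  shift-⋆ : ∀ d (f g : ℕ → ℕ) r → (shift d f ⋆ g) r ≡ shift d (f ⋆ g) r
  shift-⋆ d f g r = begin
    (shift d f ⋆ g) r                                  ≡⟨ ∑-cong (suc r) (λ i → shift-*ʳ d f (λ i → g (r ∸ i)) i) ⟩
    ∑< (suc r) (shift d (λ y → f y * g (r ∸ (d + y)))) ≡⟨ ∑-shift d (suc r) _ ⟩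
    ∑[ y < suc r ∸ d ] (f y * g (r ∸ (d + y)))         ≡⟨ truncated (d ≤? r) ⟩
    shift d (f ⋆ g) r                                  ∎
    where
    truncated : Dec (d ≤ r) → ∑[ y < suc r ∸ d ] (f y * g (r ∸ (d + y))) ≡ shift d (f ⋆ g) r
    truncated (no d≰r) = trans (cong (λ k → ∑[ y < k ] (f y * g (r ∸ (d + y)))) (m≤n⇒m∸n≡0 (≰⇒> d≰r)))
                               (sym (shift-below d (f ⋆ g) r (≰⇒> d≰r)))
    truncated (yes d≤r) = begin
      ∑[ y < suc r ∸ d ] (f y * g (r ∸ (d + y)))    ≡⟨ cong (λ k → ∑[ y < k ] (f y * g (r ∸ (d + y)))) (+-∸-assoc 1 d≤r) ⟩
      ∑[ y < suc (r ∸ d) ] (f y * g (r ∸ (d + y)))  ≡⟨ ∑-cong (suc (r ∸ d)) (λ y → cong (λ z → f y * g z) (∸-+-assoc r d y)) ⟨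
      (f ⋆ g) (r ∸ d)                               ≡⟨ shift-≥ d (f ⋆ g) d≤r ⟨
      shift d (f ⋆ g) r                             ∎

  ⋆-comm : ∀ (f g : ℕ → ℕ) r → (f ⋆ g) r ≡ (g ⋆ f) r
  ⋆-comm f g r = trans (∑-reverse (suc r) (λ i → f i * g (r ∸ i)))
    (∑-cong-< (suc r) (λ i i<1+r → trans (cong (f (r ∸ i) *_) (cong g (m∸[m∸n]≡n (≤-pred i<1+r))))
                                          (*-comm (f (r ∸ i)) (g i))))

  sum-map-zero : ∀ {A : Set} (xs : List A) {f : A → ℕ} → (∀ x → f x ≡ 0) → sum (map f xs) ≡ 0
  sum-map-zero []       vanish = refl
  sum-map-zero (x ∷ xs) vanish = cong₂ _+_ (vanish x) (sum-map-zero xs vanish)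

  sum-map-+ : ∀ {A : Set} (f g : A → ℕ) xs → sum (map (λ x → f x + g x) xs) ≡ sum (map f xs) + sum (map g xs)
  sum-map-+ f g []       = refl
  sum-map-+ f g (x ∷ xs) = begin
    f x + g x + sum (map (λ x → f x + g x) xs)          ≡⟨ cong (f x + g x +_) (sum-map-+ f g xs) ⟩
    f x + g x + (sum (map f xs) + sum (map g xs))       ≡⟨ +-interchange (f x) (g x) _ _ ⟩
    f x + sum (map f xs) + (g x + sum (map g xs))       ∎

  sum-map-comm : ∀ {A B : Set} (xs : List A) (ys : List B) (f : A → B → ℕ) →
    sum (map (λ x → sum (map (f x) ys)) xs) ≡ sum (map (λ y → sum (map (λ x → f x y) xs)) ys)
  sum-map-comm []       ys f = sym (sum-map-zero ys (λ _ → refl))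
  sum-map-comm (x ∷ xs) ys f = begin
    sum (map (f x) ys) + sum (map (λ x → sum (map (f x) ys)) xs)
      ≡⟨ cong (sum (map (f x) ys) +_) (sum-map-comm xs ys f) ⟩
    sum (map (f x) ys) + sum (map (λ y → sum (map (λ x → f x y) xs)) ys)
      ≡⟨ sum-map-+ (f x) (λ y → sum (map (λ x → f x y) xs)) ys ⟨
    sum (map (λ y → f x y + sum (map (λ x → f x y) xs)) ys) ∎

  sum-concatMap : ∀ {A B : Set} (g : B → ℕ) (F : A → List B) xs →
    sum (map g (concatMap F xs)) ≡ sum (map (λ x → sum (map g (F x))) xs)
  sum-concatMap g F []       = refl
  sum-concatMap g F (x ∷ xs) = begin
    sum (map g (F x ++ concatMap F xs))                ≡⟨ cong sum (map-++ g (F x) (concatMap F xs)) ⟩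
    sum (map g (F x) ++ map g (concatMap F xs))        ≡⟨ sum-++ (map g (F x)) _ ⟩
    sum (map g (F x)) + sum (map g (concatMap F xs))   ≡⟨ cong (sum (map g (F x)) +_) (sum-concatMap g F xs) ⟩
    sum (map g (F x)) + sum (map (λ x → sum (map g (F x))) xs) ∎

  sum-map-∘ : ∀ {A B : Set} (g : B → ℕ) (f : A → B) xs → sum (map g (map f xs)) ≡ sum (map (g ∘ f) xs)
  sum-map-∘ g f xs = cong sum (sym (map-∘ xs))

  length≡sum-map-1 : ∀ {A : Set} (xs : List A) → length xs ≡ sum (map (λ _ → 1) xs)
  length≡sum-map-1 []       = refl
  length≡sum-map-1 (x ∷ xs) = cong suc (length≡sum-map-1 xs)

  sum-filterᵇ : ∀ {A : Set} (q : A → Bool) (h : A → ℕ) xs →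
    sum (map h (filterᵇ q xs)) ≡ sum (map (λ x → if q x then h x else 0) xs)
  sum-filterᵇ q h []       = refl
  sum-filterᵇ q h (x ∷ xs) with q x
  ... | true  = cong (h x +_) (sum-filterᵇ q h xs)
  ... | false = sum-filterᵇ q h xs

  sum-upTo : ∀ (f : ℕ → ℕ) n → sum (map f (upTo n)) ≡ ∑< n f
  sum-upTo f n = go f id n
    where
    go : ∀ (f s : ℕ → ℕ) n → sum (map f (applyUpTo s n)) ≡ ∑< n (f ∘ s)
    go f s zero    = refl
    go f s (suc n) = cong (f (s 0) +_) (go f (s ∘ suc) n)

  sum-if : ∀ {A : Set} c (h : A → ℕ) (xs : List A) →
    sum (map h (if c then xs else [])) ≡ (if c then sum (map h xs) else 0)
  sum-if true  h xs = refl
  sum-if false h xs = refl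

  if-yes : ∀ {P : Set} (d : Dec P) (x : ℕ) → P → (if ⌊ d ⌋ then x else 0) ≡ x
  if-yes (yes _) x _ = refl
  if-yes (no ¬p) x p = ⊥-elim (¬p p)

  if-no : ∀ {P : Set} (d : Dec P) (x : ℕ) → ¬ P → (if ⌊ d ⌋ then x else 0) ≡ 0
  if-no (yes p) x ¬p = ⊥-elim (¬p p)
  if-no (no _)  x _  = refl

  nonIncSeqs-bound-zero : ∀ ok fuel r → nonIncSeqs ok fuel 0 (suc r) ≡ []
  nonIncSeqs-bound-zero ok zero       r = refl
  nonIncSeqs-bound-zero ok (suc fuel) r = refl

  nonIncSeqs-fuel : ∀ ok {f f'} b r → r ≤ f → r ≤ f' → nonIncSeqs ok f b r ≡ nonIncSeqs ok f' b r
  nonIncSeqs-fuel ok b zero    _ _ = refl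
  nonIncSeqs-fuel ok {suc f} {suc f'} b (suc r) (s≤s r≤f) (s≤s r≤f') =
    concatMap-cong first-part (filterᵇ (λ a → ok a ∧ ⌊ a ≤? suc r ⌋) (range1 b))
    where
    first-part : ∀ a → map (a ∷_) (nonIncSeqs ok f a (suc r ∸ a)) ≡ map (a ∷_) (nonIncSeqs ok f' a (suc r ∸ a))
    first-part zero    = cong (map (0 ∷_)) (trans (nonIncSeqs-bound-zero ok f r) (sym (nonIncSeqs-bound-zero ok f' r)))
    first-part (suc i) = cong (map (suc i ∷_))
      (nonIncSeqs-fuel ok (suc i) (r ∸ i) (≤-trans (m∸n≤m r i) r≤f) (≤-trans (m∸n≤m r i) r≤f'))

  rowSum : (ℕ → Bool) → (bound r : ℕ) → (List ℕ → ℕ) → ℕ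
  rowSum ok b r g = sum (map g (nonIncSeqs ok r b r))

  rowSum-cong : ∀ ok b r {g g' : List ℕ → ℕ} → (∀ l → g l ≡ g' l) → rowSum ok b r g ≡ rowSum ok b r g'
  rowSum-cong ok b r eq = cong sum (map-cong eq (nonIncSeqs ok r b r))

  rowSum-zero : ∀ ok b r {g : List ℕ → ℕ} → (∀ l → g l ≡ 0) → rowSum ok b r g ≡ 0
  rowSum-zero ok b r = sum-map-zero (nonIncSeqs ok r b r)

  rowSum-suc : ∀ ok b r g → rowSum ok b (suc r) g ≡
    ∑[ i < b ] (if ok (suc i) then shift i (λ y → rowSum ok (suc i) y (g ∘ (suc i ∷_))) r else 0)
  rowSum-suc ok b r g = begin
    sum (map g (concatMap F (filterᵇ q (map suc (upTo b)))))
      ≡⟨ sum-concatMap g F (filterᵇ q (map suc (upTo b))) ⟩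
    sum (map (λ a → sum (map g (F a))) (filterᵇ q (map suc (upTo b))))
      ≡⟨ sum-filterᵇ q _ (map suc (upTo b)) ⟩
    sum (map (λ a → if q a then sum (map g (F a)) else 0) (map suc (upTo b)))
      ≡⟨ sum-map-∘ _ suc (upTo b) ⟩
    sum (map (λ i → if q (suc i) then sum (map g (F (suc i))) else 0) (upTo b))
      ≡⟨ sum-upTo _ b ⟩
    ∑[ i < b ] (if q (suc i) then sum (map g (F (suc i))) else 0)
      ≡⟨ ∑-cong b term ⟩
    ∑[ i < b ] (if ok (suc i) then shift i (λ y → rowSum ok (suc i) y (g ∘ (suc i ∷_))) r else 0) ∎
    where
    q : ℕ → Bool
    q a = ok a ∧ ⌊ a ≤? suc r ⌋
    F : ℕ → List (List ℕ)
    F a = map (a ∷_) (nonIncSeqs ok r a (suc r ∸ a))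
    rest : ∀ i y → suc i + y ≡ suc r → sum (map g (F (suc i))) ≡ rowSum ok (suc i) y (g ∘ (suc i ∷_))
    rest i y refl = begin
      sum (map g (map (suc i ∷_) (nonIncSeqs ok r (suc i) (i + y ∸ i))))
        ≡⟨ sum-map-∘ g (suc i ∷_) (nonIncSeqs ok r (suc i) (i + y ∸ i)) ⟩
      sum (map (g ∘ (suc i ∷_)) (nonIncSeqs ok r (suc i) (i + y ∸ i)))
        ≡⟨ cong (λ z → sum (map (g ∘ (suc i ∷_)) (nonIncSeqs ok r (suc i) z))) (m+n∸m≡n i y) ⟩
      sum (map (g ∘ (suc i ∷_)) (nonIncSeqs ok r (suc i) y))
        ≡⟨ cong (sum ∘ map (g ∘ (suc i ∷_))) (nonIncSeqs-fuel ok (suc i) y (m≤n+m y i) ≤-refl) ⟩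
      rowSum ok (suc i) y (g ∘ (suc i ∷_)) ∎
    term : ∀ i → (if q (suc i) then sum (map g (F (suc i))) else 0)
               ≡ (if ok (suc i) then shift i (λ y → rowSum ok (suc i) y (g ∘ (suc i ∷_))) r else 0)
    term i with ok (suc i)
    ... | false = refl
    ... | true  = guarded-shift (suc i) (suc r)
                    (λ x → sum (map g (map (suc i ∷_) (nonIncSeqs ok r (suc i) (x ∸ suc i)))))
                    (λ y → rowSum ok (suc i) y (g ∘ (suc i ∷_))) (rest i)

  p≤ : (bound r : ℕ) → ℕ
  p≤ b r = rowSum (λ _ → true) b r (λ _ → 1)

  p≤-suc : ∀ b r → p≤ b (suc r) ≡ ∑[ i < b ] shift i (p≤ (suc i)) r
  p≤-suc b r = rowSum-suc (λ _ → true) b r (λ _ → 1)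

  p≤-zero : ∀ x → p≤ 0 x ≡ δ x
  p≤-zero zero    = refl
  p≤-zero (suc x) = refl

  p≤-step : ∀ b x → p≤ (suc b) x ≡ p≤ b x + shift (suc b) (p≤ (suc b)) x
  p≤-step b zero    = refl
  p≤-step b (suc r) = begin
    p≤ (suc b) (suc r)                                       ≡⟨ p≤-suc (suc b) r ⟩
    ∑[ i < suc b ] shift i (p≤ (suc i)) r                     ≡⟨ ∑-last b _ ⟩
    ∑[ i < b ] shift i (p≤ (suc i)) r + shift b (p≤ (suc b)) r ≡⟨ cong (_+ shift b (p≤ (suc b)) r) (p≤-suc b r) ⟨
    p≤ b (suc r) + shift b (p≤ (suc b)) r                    ∎

  p≤-telescope : ∀ D x → ∑[ d < suc D ] shift d (p≤ d) x ≡ p≤ D x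
  p≤-telescope zero    x = +-identityʳ _
  p≤-telescope (suc D) x = begin
    ∑[ d < suc (suc D) ] shift d (p≤ d) x                     ≡⟨ ∑-last (suc D) (λ d → shift d (p≤ d) x) ⟩
    ∑[ d < suc D ] shift d (p≤ d) x + shift (suc D) (p≤ (suc D)) x ≡⟨ cong (_+ shift (suc D) (p≤ (suc D)) x) (p≤-telescope D x) ⟩
    p≤ D x + shift (suc D) (p≤ (suc D)) x                     ≡⟨ p≤-step D x ⟨
    p≤ (suc D) x                                              ∎

  spread-p≤-telescope : ∀ D z → ∑[ d < suc D ] shift (d + d) (spread (p≤ d)) z ≡ spread (p≤ D) z
  spread-p≤-telescope D z = begin
    ∑[ d < suc D ] shift (d + d) (spread (p≤ d)) z ≡⟨ ∑-cong (suc D) (λ d → spread-shift d (p≤ d) z) ⟨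
    ∑[ d < suc D ] spread (shift d (p≤ d)) z       ≡⟨ spread-∑ (suc D) (λ d → shift d (p≤ d)) z ⟨
    spread (λ x → ∑[ d < suc D ] shift d (p≤ d) x) z ≡⟨ spread-cong z (p≤-telescope D) ⟩
    spread (p≤ D) z                                ∎

  oddᵇ-2+ : ∀ a → oddᵇ (suc (suc a)) ≡ oddᵇ a
  oddᵇ-2+ a = cong (λ r → r ≡ᵇ 1) (trans (cong (_% 2) (+-comm 2 a)) ([m+n]%n≡m%n a 2))

  ∑-odd : ∀ D (F : ℕ → ℕ) → ∑[ i < suc (D + D) ] (if oddᵇ (suc i) then F i else 0) ≡ ∑[ d < suc D ] F (d + d)
  ∑-odd zero    F = refl
  ∑-odd (suc D) F = begin
    ∑< (suc (suc D + suc D)) h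
      ≡⟨ cong (λ k → ∑< (suc k) h) (+-suc (suc D) D) ⟩
    F 0 + (0 + ∑[ i < suc (D + D) ] h (suc (suc i)))
      ≡⟨ cong (F 0 +_) (∑-cong (suc (D + D)) (λ i → cong (λ b → if b then F (suc (suc i)) else 0) (oddᵇ-2+ (suc i)))) ⟩
    F 0 + ∑[ i < suc (D + D) ] (if oddᵇ (suc i) then F (suc (suc i)) else 0)
      ≡⟨ cong (F 0 +_) (∑-odd D (F ∘ suc ∘ suc)) ⟩
    F 0 + ∑[ d < suc D ] F (suc (suc (d + d)))
      ≡⟨ cong (F 0 +_) (∑-cong (suc D) (λ d → cong (F ∘ suc) (+-suc d d))) ⟨
    F 0 + ∑[ d < suc D ] F (suc d + suc d) ∎
    where
    h : ℕ → ℕ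
    h i = if oddᵇ (suc i) then F i else 0

  oddRowSum : (D r : ℕ) → (List ℕ → ℕ) → ℕ
  oddRowSum D = rowSum oddᵇ (suc (D + D))

  oddRowSum-suc : ∀ D r g → oddRowSum D (suc r) g ≡
    ∑[ d < suc D ] shift (d + d) (λ y → oddRowSum d y (g ∘ (suc (d + d) ∷_))) r
  oddRowSum-suc D r g = trans (rowSum-suc oddᵇ (suc (D + D)) r g)
    (∑-odd D (λ i → shift i (λ y → rowSum oddᵇ (suc i) y (g ∘ (suc i ∷_))) r))

  oddRowsOfLength : (D j s : ℕ) → ℕ
  oddRowsOfLength D j s = oddRowSum D j (λ l → if length l ≡ᵇ s then 1 else 0)

  -- Subtracting 1 from each of the s parts and halving gives a partition of (j - s)/2
  -- into parts ≤ D; it has at most s parts automatically once j ≤ 3s.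
  oddRowsOfLength-spread : ∀ s D j → D ≡ 0 ⊎ j ≤ 3 * s → oddRowsOfLength D j s ≡ shift s (spread (p≤ D)) j
  oddRowsOfLength-spread zero    D       zero    _           = refl
  oddRowsOfLength-spread zero    .zero   (suc j) (inj₁ refl) = begin
    oddRowsOfLength 0 (suc j) 0 ≡⟨ oddRowSum-suc 0 j _ ⟩
    shift 0 (λ y → oddRowSum 0 y (λ _ → 0)) j + 0 ≡⟨ cong (_+ 0) (rowSum-zero oddᵇ 1 j (λ _ → refl)) ⟩
    0                           ≡⟨ p≤0-spread-suc j ⟨
    spread (p≤ 0) (suc j)       ∎
    where
    p≤0-spread-suc : ∀ j → spread (p≤ 0) (suc j) ≡ 0
    p≤0-spread-suc zero    = refl
    p≤0-spread-suc (suc j) = spread-zero j (p≤ 0 ∘ suc) (λ x → refl)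
  oddRowsOfLength-spread (suc s) D       zero    _           = refl
  oddRowsOfLength-spread (suc s) D       (suc j) bound       = begin
    oddRowsOfLength D (suc j) (suc s)
      ≡⟨ oddRowSum-suc D j _ ⟩
    ∑[ d < suc D ] shift (d + d) (λ y → oddRowsOfLength d y s) j
      ≡⟨ ∑-cong-< (suc D) (λ d d<1+D → shift-cong (d + d) j
           (λ y e → oddRowsOfLength-spread s d y (inner-bound d y (≤-pred d<1+D) e bound))) ⟩
    ∑[ d < suc D ] shift (d + d) (shift s (spread (p≤ d))) j
      ≡⟨ ∑-cong (suc D) (λ d → shift-comm (d + d) s (spread (p≤ d)) j) ⟩
    ∑[ d < suc D ] shift s (shift (d + d) (spread (p≤ d))) j
      ≡⟨ shift-∑ s (suc D) (λ d → shift (d + d) (spread (p≤ d))) j ⟨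
    shift s (λ z → ∑[ d < suc D ] shift (d + d) (spread (p≤ d)) z) j
      ≡⟨ shift-cong s j (λ z _ → spread-p≤-telescope D z) ⟩
    shift s (spread (p≤ D)) j ∎
    where
    inner-bound : ∀ d y → d ≤ D → d + d + y ≡ j → D ≡ 0 ⊎ suc j ≤ 3 * suc s → d ≡ 0 ⊎ y ≤ 3 * s
    inner-bound zero    y _   _ _           = inj₁ refl
    inner-bound (suc d) y ()  _ (inj₁ refl)
    inner-bound (suc d) y d≤D refl (inj₂ j<) = inj₂ (+-cancelˡ-≤ 3 y (3 * s)
      (≤-trans (+-monoʳ-≤ 3 (m≤m+n y (d + d)))
      (≤-trans (≤-reflexive (rearrange d y))
      (≤-trans j< (≤-reflexive (*-suc 3 s))))))
      where
      rearrange : ∀ d y → 3 + (y + (d + d)) ≡ suc (suc d + suc d + y)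
      rearrange = solve-∀

  oddRowsWeighted : (D j : ℕ) → (ℕ → ℕ) → ℕ
  oddRowsWeighted D j ψ = oddRowSum D j (λ l → ψ (j + length l))

  oddRowsWeighted-zero : ∀ D j ψ → (∀ z → j ≤ z → ψ z ≡ 0) → oddRowsWeighted D j ψ ≡ 0
  oddRowsWeighted-zero D j ψ vanish = rowSum-zero oddᵇ (suc (D + D)) j (λ l → vanish (j + length l) (m≤m+n j _))

  oddRowsWeighted-suc : ∀ D j ψ → oddRowsWeighted D (suc j) ψ ≡
    ∑[ d < suc D ] shift (d + d) (λ y → oddRowsWeighted d y (ψ ∘ (_+ suc (suc (d + d))))) j
  oddRowsWeighted-suc D j ψ = trans (oddRowSum-suc D j _)
    (∑-cong (suc D) (λ d → shift-cong (d + d)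
      {λ y → oddRowSum d y (λ l → ψ (suc j + length (suc (d + d) ∷ l)))}
      {λ y → oddRowsWeighted d y (ψ ∘ (_+ suc (suc (d + d))))} j (λ { y refl →
      rowSum-cong oddᵇ (suc (d + d)) y (λ l → cong ψ (rearrange d y (length l))) })))
    where
    rearrange : ∀ d y k → suc (d + d + y) + suc k ≡ y + k + suc (suc (d + d))
    rearrange = solve-∀

  -- Halve b + 1 for every part b; the support bound N of ψ is only the induction measure.
  ∑-oddRowsWeighted : ∀ N D (ψ : ℕ → ℕ) → (∀ z → N ≤ z → ψ z ≡ 0) → ∀ M → N ≤ M →
    ∑[ j < M ] oddRowsWeighted D j ψ ≡ ∑[ Y < M ] (p≤ (suc D) Y * ψ (Y + Y))
  ∑-oddRowsWeighted zero    D ψ vanish M _ =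
    trans (∑-zero M (λ j _ → oddRowsWeighted-zero D j ψ (λ z _ → vanish z z≤n)))
          (sym (∑-zero M (λ Y _ → trans (cong (p≤ (suc D) Y *_) (vanish (Y + Y) z≤n)) (*-zeroʳ (p≤ (suc D) Y)))))
  ∑-oddRowsWeighted (suc N) D ψ vanish (suc M) (s≤s N≤M) = begin
    oddRowsWeighted D 0 ψ + ∑[ j < M ] oddRowsWeighted D (suc j) ψ
      ≡⟨ cong (ψ 0 + 0 +_) (∑-cong M (λ j → oddRowsWeighted-suc D j ψ)) ⟩
    ψ 0 + 0 + ∑[ j < M ] ∑[ d < suc D ] shift (d + d) (λ y → oddRowsWeighted d y (ψ₊ d)) j
      ≡⟨ cong (ψ 0 + 0 +_) (∑-comm M (suc D) (λ j d → shift (d + d) (λ y → oddRowsWeighted d y (ψ₊ d)) j)) ⟩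
    ψ 0 + 0 + ∑[ d < suc D ] ∑[ j < M ] shift (d + d) (λ y → oddRowsWeighted d y (ψ₊ d)) j
      ≡⟨ cong (ψ 0 + 0 +_) (∑-cong (suc D) (λ d → trans (removed-part d) (halved-part d))) ⟩
    ψ 0 + 0 + ∑[ d < suc D ] ∑[ Y < M ] (shift d (p≤ (suc d)) Y * ψ (suc Y + suc Y))
      ≡⟨ cong (ψ 0 + 0 +_) (∑-comm (suc D) M (λ d Y → shift d (p≤ (suc d)) Y * ψ (suc Y + suc Y))) ⟩
    ψ 0 + 0 + ∑[ Y < M ] ∑[ d < suc D ] (shift d (p≤ (suc d)) Y * ψ (suc Y + suc Y))
      ≡⟨ cong (ψ 0 + 0 +_) (∑-cong M (λ Y → trans (∑-distribʳ-* (suc D) (λ d → shift d (p≤ (suc d)) Y) _)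
                                                    (cong (_* ψ (suc Y + suc Y)) (sym (p≤-suc (suc D) Y))))) ⟩
    ψ 0 + 0 + ∑[ Y < M ] (p≤ (suc D) (suc Y) * ψ (suc Y + suc Y)) ∎
    where
    ψ₊ : ℕ → ℕ → ℕ
    ψ₊ d z = ψ (z + suc (suc (d + d)))
    removed-part : ∀ d → ∑[ j < M ] shift (d + d) (λ y → oddRowsWeighted d y (ψ₊ d)) j
                       ≡ ∑[ Y < suc M ] (p≤ (suc d) Y * ψ₊ d (Y + Y))
    removed-part d = begin
      ∑[ j < M ] shift (d + d) (λ y → oddRowsWeighted d y (ψ₊ d)) j
        ≡⟨ ∑-shift (d + d) M (λ y → oddRowsWeighted d y (ψ₊ d)) ⟩
      ∑[ y < M ∸ (d + d) ] oddRowsWeighted d y (ψ₊ d)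
        ≡⟨ ∑-truncate (M ∸ (d + d)) (suc M) _ (≤-trans (m∸n≤m M (d + d)) (n≤1+n M))
             (λ i M∸2d≤i _ → oddRowsWeighted-zero d i (ψ₊ d) (λ z i≤z → vanish _ (beyond i z M∸2d≤i i≤z))) ⟨
      ∑[ y < suc M ] oddRowsWeighted d y (ψ₊ d)
        ≡⟨ ∑-oddRowsWeighted N d (ψ₊ d) (λ z N≤z → vanish _ (shifted-support z N≤z)) (suc M) (m≤n⇒m≤1+n N≤M) ⟩
      ∑[ Y < suc M ] (p≤ (suc d) Y * ψ₊ d (Y + Y)) ∎
      where
      shifted-support : ∀ z → N ≤ z → suc N ≤ z + suc (suc (d + d))
      shifted-support z N≤z = ≤-trans (s≤s (≤-trans N≤z (m≤m+n z (suc (d + d))))) (≤-reflexive (sym (+-suc z _)))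
      beyond : ∀ i z → M ∸ (d + d) ≤ i → i ≤ z → suc N ≤ z + suc (suc (d + d))
      beyond i z M∸2d≤i i≤z =
        ≤-trans (s≤s (≤-trans N≤M (≤-trans (m≤n+m∸n M (d + d)) (+-monoʳ-≤ (d + d) (≤-trans M∸2d≤i i≤z)))))
                (≤-trans (n≤1+n _) (≤-reflexive (rearrange d z)))
        where
        rearrange : ∀ d z → suc (suc (d + d + z)) ≡ z + suc (suc (d + d))
        rearrange = solve-∀
    halved-part : ∀ d → ∑[ Y < suc M ] (p≤ (suc d) Y * ψ₊ d (Y + Y))
                      ≡ ∑[ Y < M ] (shift d (p≤ (suc d)) Y * ψ (suc Y + suc Y))
    halved-part d = begin
      ∑[ Y < suc M ] (p≤ (suc d) Y * ψ₊ d (Y + Y))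
        ≡⟨ ∑-truncate (M ∸ d) (suc M) _ (≤-trans (m∸n≤m M d) (n≤1+n M))
             (λ Y M∸d≤Y _ → trans (cong (p≤ (suc d) Y *_) (vanish _ (beyond Y M∸d≤Y))) (*-zeroʳ (p≤ (suc d) Y))) ⟩
      ∑[ Y < M ∸ d ] (p≤ (suc d) Y * ψ₊ d (Y + Y))
        ≡⟨ ∑-cong (M ∸ d) (λ Y → cong (λ z → p≤ (suc d) Y * ψ z) (rearrange d Y)) ⟩
      ∑[ y < M ∸ d ] (p≤ (suc d) y * ψ (suc (d + y) + suc (d + y)))
        ≡⟨ ∑-shift d M (λ y → p≤ (suc d) y * ψ (suc (d + y) + suc (d + y))) ⟨
      ∑[ Y < M ] shift d (λ y → p≤ (suc d) y * ψ (suc (d + y) + suc (d + y))) Y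
        ≡⟨ ∑-cong M (λ Y → shift-*ʳ d (p≤ (suc d)) (λ Y → ψ (suc Y + suc Y)) Y) ⟨
      ∑[ Y < M ] (shift d (p≤ (suc d)) Y * ψ (suc Y + suc Y)) ∎
      where
      rearrange : ∀ d y → y + y + suc (suc (d + d)) ≡ suc (d + y) + suc (d + y)
      rearrange = solve-∀
      beyond : ∀ Y → M ∸ d ≤ Y → suc N ≤ Y + Y + suc (suc (d + d))
      beyond Y M∸d≤Y = ≤-trans (s≤s (≤-trans N≤M (≤-trans (m≤n+m∸n M d) (+-monoʳ-≤ d M∸d≤Y))))
                              (≤-trans (m≤m+n (suc (d + Y)) (suc (d + Y))) (≤-reflexive (sym (rearrange d Y))))

  -- Durfee rectangles

  -- Partitions of x into at most L parts, each ≤ w.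
  box : (L w x : ℕ) → ℕ
  box zero    w       = δ
  box (suc L) zero    = δ
  box (suc L) (suc w) x = box (suc L) w x + shift (suc w) (box L (suc w)) x

  box-zeroʳ : ∀ L x → box L 0 x ≡ δ x
  box-zeroʳ zero    x = refl
  box-zeroʳ (suc L) x = refl

  box-one : ∀ w x → box 1 (suc w) x ≡ δ x + shift 1 (box 1 w) x
  box-one zero    x = refl
  box-one (suc w) x = begin
    box 1 (suc w) x + shift (suc (suc w)) δ x               ≡⟨ cong (_+ shift (suc (suc w)) δ x) (box-one w x) ⟩
    δ x + shift 1 (box 1 w) x + shift (suc (suc w)) δ x     ≡⟨ +-assoc (δ x) _ _ ⟩
    δ x + (shift 1 (box 1 w) x + shift (suc (suc w)) δ x)   ≡⟨ cong (λ z → δ x + (shift 1 (box 1 w) x + z)) (shift-shift 1 (suc w) δ x) ⟨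
    δ x + (shift 1 (box 1 w) x + shift 1 (shift (suc w) δ) x) ≡⟨ cong (δ x +_) (shift-+ 1 (box 1 w) (shift (suc w) δ) x) ⟨
    δ x + shift 1 (box 1 (suc w)) x                         ∎

  -- The recurrence conjugate to the definition.
  box-step : ∀ L w x → box (suc L) (suc w) x ≡ box L (suc w) x + shift (suc L) (box (suc L) w) x
  box-step zero    w       x = box-one w x
  box-step (suc L) zero    x = begin
    δ x + shift 1 (box (suc L) 1) x                                 ≡⟨ cong (δ x +_) (shift-cong 1 x (λ y _ → box-step L zero y)) ⟩
    δ x + shift 1 (λ y → box L 1 y + shift (suc L) δ y) x            ≡⟨ cong (δ x +_) (shift-+ 1 (box L 1) _ x) ⟩
    δ x + (shift 1 (box L 1) x + shift 1 (shift (suc L) δ) x)        ≡⟨ cong (λ z → δ x + (shift 1 (box L 1) x + z)) (shift-shift 1 (suc L) δ x) ⟩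
    δ x + (shift 1 (box L 1) x + shift (suc (suc L)) δ x)            ≡⟨ +-assoc (δ x) _ _ ⟨
    δ x + shift 1 (box L 1) x + shift (suc (suc L)) δ x              ∎
  box-step (suc L) (suc w) x = begin
    box (suc (suc L)) (suc w) x + shift (suc (suc w)) (box (suc L) (suc (suc w))) x
      ≡⟨ cong₂ _+_ (box-step (suc L) w x)
                   (trans (shift-cong (suc (suc w)) x (λ y _ → box-step L (suc w) y)) (shift-+ (suc (suc w)) _ _ x)) ⟩
    (a + b) + (c + d)
      ≡⟨ +-interchange a b c d ⟩
    (a + c) + (b + d)
      ≡⟨ cong (λ z → a + c + (b + z)) moved ⟩
    box (suc L) (suc (suc w)) x + (b + shift (suc (suc L)) (shift (suc w) (box (suc L) (suc w))) x)
      ≡⟨ cong (box (suc L) (suc (suc w)) x +_) (shift-+ (suc (suc L)) (box (suc (suc L)) w) _ x) ⟨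
    box (suc L) (suc (suc w)) x + shift (suc (suc L)) (box (suc (suc L)) (suc w)) x ∎
    where
    a = box (suc L) (suc w) x
    b = shift (suc (suc L)) (box (suc (suc L)) w) x
    c = shift (suc (suc w)) (box L (suc (suc w))) x
    d = shift (suc (suc w)) (shift (suc L) (box (suc L) (suc w))) x
    moved : d ≡ shift (suc (suc L)) (shift (suc w) (box (suc L) (suc w))) x
    moved = begin
      d                                                    ≡⟨ shift-shift (suc (suc w)) (suc L) _ x ⟩
      shift (suc (suc w) + suc L) (box (suc L) (suc w)) x  ≡⟨ cong (λ k → shift k (box (suc L) (suc w)) x) (+-comm (suc (suc w)) (suc L)) ⟩
      shift (suc L + suc (suc w)) (box (suc L) (suc w)) x  ≡⟨ cong (λ k → shift (suc k) (box (suc L) (suc w)) x) (+-suc L (suc w)) ⟩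
      shift (suc (suc L) + suc w) (box (suc L) (suc w)) x  ≡⟨ shift-shift (suc (suc L)) (suc w) _ x ⟨
      shift (suc (suc L)) (shift (suc w) (box (suc L) (suc w))) x ∎

  box≡p≤ : ∀ D w x → D ≡ 0 ⊎ x ≤ w → box D w x ≡ p≤ D x
  box≡p≤ zero    w       x _              = sym (p≤-zero x)
  box≡p≤ (suc D) zero    zero _           = refl
  box≡p≤ (suc D) zero    (suc x) (inj₂ ())
  box≡p≤ (suc D) (suc w) x (inj₂ x≤1+w)   = begin
    box (suc D) (suc w) x                                   ≡⟨ box-step D w x ⟩
    box D (suc w) x + shift (suc D) (box (suc D) w) x       ≡⟨ cong₂ _+_ (box≡p≤ D (suc w) x (inj₂ x≤1+w))
                                                                      (shift-cong (suc D) x (λ y e → box≡p≤ (suc D) w y (inj₂ (fits y e)))) ⟩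
    p≤ D x + shift (suc D) (p≤ (suc D)) x                   ≡⟨ p≤-step D x ⟨
    p≤ (suc D) x                                            ∎
    where
    fits : ∀ y → suc D + y ≡ x → y ≤ w
    fits y refl = m+n≤o⇒n≤o D (≤-pred x≤1+w)

  -- Partitions with parts ≤ c + e, classified by their largest D × (D + c) rectangle.
  durfeeTerm : (c e D : ℕ) → ℕ → ℕ
  durfeeTerm c e D = shift (D * (D + c)) (box D (e ∸ D) ⋆ p≤ (D + c))

  durfeeSum : (c e r : ℕ) → ℕ
  durfeeSum c e r = ∑[ D < suc e ] durfeeTerm c e D r

  durfeeTerm-widen : ∀ c e D r → D ≤ e →
    shift (suc D * (suc D + c)) (shift (e ∸ D) (box D (e ∸ D) ⋆ p≤ (suc D + c))) r
      ≡ shift (suc (c + e)) (durfeeTerm (suc c) e D) r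
  durfeeTerm-widen c e D r D≤e = begin
    shift (suc D * (suc D + c)) (shift (e ∸ D) h) r                ≡⟨ shift-shift (suc D * (suc D + c)) (e ∸ D) h r ⟩
    shift (suc D * (suc D + c) + (e ∸ D)) h r                       ≡⟨ cong (λ k → shift k h r) corner ⟩
    shift (suc (c + e) + D * (D + suc c)) h r                       ≡⟨ shift-shift (suc (c + e)) (D * (D + suc c)) h r ⟨
    shift (suc (c + e)) (shift (D * (D + suc c)) h) r               ≡⟨ cong (λ k → shift (suc (c + e)) (shift (D * (D + suc c)) (box D (e ∸ D) ⋆ p≤ k)) r)
                                                                                (sym (+-suc D c)) ⟩
    shift (suc (c + e)) (durfeeTerm (suc c) e D) r                  ∎
    where
    h : ℕ → ℕ
    h = box D (e ∸ D) ⋆ p≤ (suc D + c)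
    rearrange : ∀ D c t → suc D * (suc D + c) + t ≡ suc (c + (D + t)) + D * (D + suc c)
    rearrange = solve-∀
    corner : suc D * (suc D + c) + (e ∸ D) ≡ suc (c + e) + D * (D + suc c)
    corner = trans (rearrange D c (e ∸ D)) (cong (λ k → suc (c + k) + D * (D + suc c)) (m+[n∸m]≡n D≤e))

  durfeeTerm-split : ∀ c e D r → D < e →
    durfeeTerm c (suc e) (suc D) r ≡ durfeeTerm c e (suc D) r + shift (suc (c + e)) (durfeeTerm (suc c) e D) r
  durfeeTerm-split c e D r D<e = begin
    shift A (box (suc D) (e ∸ D) ⋆ g) r
      ≡⟨ cong (λ w → shift A (box (suc D) w ⋆ g) r) e∸D≡1+w ⟩
    shift A (box (suc D) (suc w) ⋆ g) r
      ≡⟨ shift-cong A r (λ y _ → ⋆-distribʳ-+ (box (suc D) w) (shift (suc w) (box D (suc w))) g y) ⟩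
    shift A (λ y → (box (suc D) w ⋆ g) y + (shift (suc w) (box D (suc w)) ⋆ g) y) r
      ≡⟨ shift-+ A (box (suc D) w ⋆ g) _ r ⟩
    durfeeTerm c e (suc D) r + shift A (shift (suc w) (box D (suc w)) ⋆ g) r
      ≡⟨ cong (durfeeTerm c e (suc D) r +_) (shift-cong A r (λ y _ → shift-⋆ (suc w) (box D (suc w)) g y)) ⟩
    durfeeTerm c e (suc D) r + shift A (shift (suc w) (box D (suc w) ⋆ g)) r
      ≡⟨ cong (λ v → durfeeTerm c e (suc D) r + shift A (shift v (box D v ⋆ g)) r) e∸D≡1+w ⟨
    durfeeTerm c e (suc D) r + shift A (shift (e ∸ D) (box D (e ∸ D) ⋆ g)) r
      ≡⟨ cong (durfeeTerm c e (suc D) r +_) (durfeeTerm-widen c e D r (<⇒≤ D<e)) ⟩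
    durfeeTerm c e (suc D) r + shift (suc (c + e)) (durfeeTerm (suc c) e D) r ∎
    where
    A = suc D * (suc D + c)
    g = p≤ (suc D + c)
    w = e ∸ suc D
    e∸D≡1+w : e ∸ D ≡ suc w
    e∸D≡1+w = +-∸-assoc 1 D<e

  durfeeTerm-last : ∀ c e r → durfeeTerm c (suc e) (suc e) r ≡ shift (suc (c + e)) (durfeeTerm (suc c) e e) r
  durfeeTerm-last c e r = begin
    shift A (box (suc e) (e ∸ e) ⋆ g) r                ≡⟨ cong (λ w → shift A (box (suc e) w ⋆ g) r) (n∸n≡0 e) ⟩
    shift A (δ ⋆ g) r                                  ≡⟨ shift-cong A r (λ y _ → ⋆-congˡ y g (λ i _ → sym (box-zeroʳ e i))) ⟩
    shift A (box e 0 ⋆ g) r                            ≡⟨ cong (λ w → shift A (shift w (box e w ⋆ g)) r) (n∸n≡0 e) ⟨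
    shift A (shift (e ∸ e) (box e (e ∸ e) ⋆ g)) r      ≡⟨ durfeeTerm-widen c e e r ≤-refl ⟩
    shift (suc (c + e)) (durfeeTerm (suc c) e e) r     ∎
    where
    A = suc e * (suc e + c)
    g = p≤ (suc e + c)

  durfeeSum-suc : ∀ c e r → durfeeSum c (suc e) r ≡ durfeeSum c e r + shift (suc (c + e)) (durfeeSum (suc c) e) r
  durfeeSum-suc c e r = begin
    T₀ + ∑[ D < suc e ] durfeeTerm c (suc e) (suc D) r
      ≡⟨ cong (T₀ +_) (∑-last e (λ D → durfeeTerm c (suc e) (suc D) r)) ⟩
    T₀ + (∑[ D < e ] durfeeTerm c (suc e) (suc D) r + durfeeTerm c (suc e) (suc e) r)
      ≡⟨ cong (T₀ +_) (cong₂ _+_ (∑-cong-< e (λ D D<e → durfeeTerm-split c e D r D<e)) (durfeeTerm-last c e r)) ⟩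
    T₀ + (∑[ D < e ] (durfeeTerm c e (suc D) r + U D) + U e)
      ≡⟨ cong (λ z → T₀ + (z + U e)) (∑-distrib-+ e (λ D → durfeeTerm c e (suc D) r) U) ⟩
    T₀ + (∑[ D < e ] durfeeTerm c e (suc D) r + ∑< e U + U e)
      ≡⟨ cong (T₀ +_) (+-assoc _ (∑< e U) (U e)) ⟩
    T₀ + (∑[ D < e ] durfeeTerm c e (suc D) r + (∑< e U + U e))
      ≡⟨ +-assoc T₀ _ _ ⟨
    durfeeSum c e r + (∑< e U + U e)
      ≡⟨ cong (durfeeSum c e r +_) (∑-last e U) ⟨
    durfeeSum c e r + ∑< (suc e) U
      ≡⟨ cong (durfeeSum c e r +_) (shift-∑ (suc (c + e)) (suc e) (durfeeTerm (suc c) e) r) ⟨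
    durfeeSum c e r + shift (suc (c + e)) (durfeeSum (suc c) e) r ∎
    where
    T₀ = durfeeTerm c e 0 r
    U : ℕ → ℕ
    U D = shift (suc (c + e)) (durfeeTerm (suc c) e D) r

  p≤-durfee : ∀ c e r → p≤ (c + e) r ≡ durfeeSum c e r
  p≤-durfee c zero    r = begin
    p≤ (c + 0) r   ≡⟨ cong (λ k → p≤ k r) (+-identityʳ c) ⟩
    p≤ c r         ≡⟨ δ-⋆ (p≤ c) r ⟨
    (δ ⋆ p≤ c) r   ≡⟨ +-identityʳ _ ⟨
    durfeeSum c 0 r ∎
  p≤-durfee c (suc e) r = begin
    p≤ (c + suc e) r                                           ≡⟨ cong (λ k → p≤ k r) (+-suc c e) ⟩
    p≤ (suc (c + e)) r                                         ≡⟨ p≤-step (c + e) r ⟩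
    p≤ (c + e) r + shift (suc (c + e)) (p≤ (suc (c + e))) r    ≡⟨ cong₂ _+_ (p≤-durfee c e r)
                                                                          (shift-cong (suc (c + e)) r (λ y _ → p≤-durfee (suc c) e y)) ⟩
    durfeeSum c e r + shift (suc (c + e)) (durfeeSum (suc c) e) r ≡⟨ durfeeSum-suc c e r ⟨
    durfeeSum c (suc e) r                                      ∎

  p≡p≤ : ∀ k → p k ≡ p≤ k k
  p≡p≤ k = length≡sum-map-1 (partitions k)

  rectangle-area : ∀ D → 2 + D ≤ suc D * (suc D + 1)
  rectangle-area D = ≤-trans (≤-reflexive (cong suc (+-comm 1 D))) (s≤s (m≤m+n (D + 1) _))

  p≡∑-rectangles : ∀ k L → k ≤ L → p k ≡ ∑[ D < suc L ] shift (D * (D + 1)) (p≤ D ⋆ p≤ (suc D)) k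
  p≡∑-rectangles zero    L _   = cong suc (sym (∑-zero L (λ _ _ → refl)))
  p≡∑-rectangles (suc k) L k<L = begin
    p (suc k)                                             ≡⟨ p≡p≤ (suc k) ⟩
    p≤ (1 + k) (suc k)                                    ≡⟨ p≤-durfee 1 k (suc k) ⟩
    durfeeSum 1 k (suc k)                                 ≡⟨ ∑-cong-< (suc k) (λ D D<1+k → shift-cong (D * (D + 1)) (suc k) (in-box D)) ⟩
    ∑[ D < suc k ] term D                                 ≡⟨ ∑-truncate (suc k) (suc L) term (s≤s (<⇒≤ k<L)) too-large ⟨
    ∑[ D < suc L ] term D                                 ∎
    where
    term : ℕ → ℕ
    term D = shift (D * (D + 1)) (p≤ D ⋆ p≤ (suc D)) (suc k)
    fits : ∀ D y i → i ≤ y → D * (D + 1) + y ≡ suc k → D ≡ 0 ⊎ i ≤ k ∸ D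
    fits zero    y i _   _  = inj₁ refl
    fits (suc D) y i i≤y eq = inj₂ (≤-trans i≤y (m+n≤o⇒m≤o∸n y
      (≤-trans (+-monoʳ-≤ y (rectangle-area D)) (≤-reflexive (trans (+-comm y _) eq)))))
    in-box : ∀ D y → D * (D + 1) + y ≡ suc k → (box D (k ∸ D) ⋆ p≤ (D + 1)) y ≡ (p≤ D ⋆ p≤ (suc D)) y
    in-box D y eq = trans (⋆-congˡ y (p≤ (D + 1)) (λ i i≤y → box≡p≤ D (k ∸ D) i (fits D y i i≤y eq)))
                          (cong (λ b → (p≤ D ⋆ p≤ b) y) (+-comm D 1))
    too-large : ∀ D → suc k ≤ D → D < suc L → term D ≡ 0
    too-large (suc D) k<1+D _ = shift-below (suc D * (suc D + 1)) _ (suc k) (≤-trans (s≤s k<1+D) (rectangle-area D))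

  -- Odd Durfee symbols with a given D

  rank-test : ∀ a b m → ⌊ (ℤ.+ a) ℤ.- (ℤ.+ b) ℤ.≟ ℤ.+ m ⌋ ≡ (a ≡ᵇ b + m)
  rank-test a b m with (ℤ.+ a) ℤ.- (ℤ.+ b) ℤ.≟ ℤ.+ m | a ≡ᵇ b + m in test
  ... | yes _     | true  = refl
  ... | no  _     | false = refl
  ... | yes a-b≡m | false = ⊥-elim (subst T test (≡⇒≡ᵇ a (b + m) a≡b+m))
    where
    minus-plus : ∀ (i j : ℤ.ℤ) → i ≡ i ℤ.- j ℤ.+ j
    minus-plus = solveℤ-∀
    a≡b+m : a ≡ b + m
    a≡b+m = ℤP.+-injective (begin
      ℤ.+ a                          ≡⟨ minus-plus (ℤ.+ a) (ℤ.+ b) ⟩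
      (ℤ.+ a) ℤ.- (ℤ.+ b) ℤ.+ ℤ.+ b  ≡⟨ cong (ℤ._+ ℤ.+ b) a-b≡m ⟩
      ℤ.+ m ℤ.+ ℤ.+ b                ≡⟨ ℤP.pos-+ m b ⟨
      ℤ.+ (m + b)                    ≡⟨ cong ℤ.+_ (+-comm m b) ⟩
      ℤ.+ (b + m)                    ∎)
  ... | no a-b≢m  | true  = ⊥-elim (a-b≢m (a-b≡m (≡ᵇ⇒≡ a (b + m) (subst T (sym test) _))))
    where
    plus-minus : ∀ (i j : ℤ.ℤ) → i ℤ.+ j ℤ.- i ≡ j
    plus-minus = solveℤ-∀
    a-b≡m : a ≡ b + m → (ℤ.+ a) ℤ.- (ℤ.+ b) ≡ ℤ.+ m
    a-b≡m refl = trans (cong (ℤ._- ℤ.+ b) (ℤP.pos-+ b m)) (plus-minus (ℤ.+ b) (ℤ.+ m))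

  durfeeBase : ℕ → ℕ
  durfeeBase D = 2 * D * D + 2 * D + 1

  rowPairs : (m D R j : ℕ) → ℕ
  rowPairs m D R j = oddRowSum D (R ∸ j) (λ bot → oddRowsOfLength D j (length bot + m))

  symbolsWithDurfee : (m n D : ℕ) → ℕ
  symbolsWithDurfee m n D =
    ∑[ j < suc n ] (if ⌊ durfeeBase D + j ≤? n ⌋ then rowPairs m D (n ∸ durfeeBase D) j else 0)

  sum-oddRows : ∀ D r (f : List ℕ → ℕ) → sum (map f (oddRows D r)) ≡ oddRowSum D r f
  sum-oddRows D r f = cong (λ b → sum (map f (nonIncSeqs oddᵇ r b r))) (2D+1 D)
    where
    2D+1 : ∀ D → 2 * D + 1 ≡ suc (D + D)
    2D+1 = solve-∀

  hasRank : ℕ → OddDurfeeSymbol → ℕ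
  hasRank m σ = if ⌊ oddRank σ ℤ.≟ ℤ.+ m ⌋ then 1 else 0

  rowPairs-symbols : ∀ m D j R →
    sum (map (hasRank m) (concatMap (λ top → map (λ bot → (D , top , bot)) (oddRows D (R ∸ j))) (oddRows D j)))
      ≡ rowPairs m D R j
  rowPairs-symbols m D j R = begin
    sum (map (hasRank m) (concatMap (λ top → map (λ bot → (D , top , bot)) bots) tops))
      ≡⟨ sum-concatMap (hasRank m) _ tops ⟩
    sum (map (λ top → sum (map (hasRank m) (map (λ bot → (D , top , bot)) bots))) tops)
      ≡⟨ cong sum (map-cong (λ top → trans (sum-map-∘ (hasRank m) _ bots)
           (cong sum (map-cong (λ bot → cong (λ b → if b then 1 else 0) (rank-test (length top) (length bot) m)) bots))) tops) ⟩
    sum (map (λ top → sum (map (λ bot → lengths-match top bot) bots)) tops)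
      ≡⟨ sum-map-comm tops bots lengths-match ⟩
    sum (map (λ bot → sum (map (λ top → lengths-match top bot) tops)) bots)
      ≡⟨ sum-oddRows D (R ∸ j) _ ⟩
    oddRowSum D (R ∸ j) (λ bot → sum (map (λ top → lengths-match top bot) tops))
      ≡⟨ rowSum-cong oddᵇ (suc (D + D)) (R ∸ j) (λ bot → sum-oddRows D j _) ⟩
    rowPairs m D R j ∎
    where
    tops = oddRows D j
    bots = oddRows D (R ∸ j)
    lengths-match : List ℕ → List ℕ → ℕ
    lengths-match top bot = if length top ≡ᵇ length bot + m then 1 else 0

  N⁰-split : ∀ m n → N⁰ (ℤ.+ m) n ≡ ∑[ D < suc n ] symbolsWithDurfee m n D
  N⁰-split m n = begin
    length (filterᵇ rank-m (oddDurfeeSymbols n))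
      ≡⟨ length≡sum-map-1 (filterᵇ rank-m (oddDurfeeSymbols n)) ⟩
    sum (map (λ _ → 1) (filterᵇ rank-m (oddDurfeeSymbols n)))
      ≡⟨ sum-filterᵇ rank-m (λ _ → 1) (oddDurfeeSymbols n) ⟩
    sum (map (hasRank m) (oddDurfeeSymbols n))
      ≡⟨ sum-concatMap (hasRank m) (λ D → concatMap (withTopWeight D) (upTo (suc n))) (upTo (suc n)) ⟩
    sum (map (λ D → sum (map (hasRank m) (concatMap (withTopWeight D) (upTo (suc n))))) (upTo (suc n)))
      ≡⟨ sum-upTo _ (suc n) ⟩
    ∑[ D < suc n ] sum (map (hasRank m) (concatMap (withTopWeight D) (upTo (suc n))))
      ≡⟨ ∑-cong (suc n) (λ D → trans (sum-concatMap (hasRank m) (withTopWeight D) (upTo (suc n))) (sum-upTo _ (suc n))) ⟩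
    ∑[ D < suc n ] ∑[ j < suc n ] sum (map (hasRank m) (withTopWeight D j))
      ≡⟨ ∑-cong (suc n) (λ D → ∑-cong (suc n) (λ j → per-part D j)) ⟩
    ∑[ D < suc n ] symbolsWithDurfee m n D ∎
    where
    rank-m : OddDurfeeSymbol → Bool
    rank-m σ = ⌊ oddRank σ ℤ.≟ ℤ.+ m ⌋
    withTopWeight : ℕ → ℕ → List OddDurfeeSymbol
    withTopWeight D j = if ⌊ durfeeBase D + j ≤? n ⌋
      then concatMap (λ top → map (λ bot → (D , top , bot)) (oddRows D ((n ∸ durfeeBase D) ∸ j))) (oddRows D j)
      else []
    per-part : ∀ D j → sum (map (hasRank m) (withTopWeight D j))
                       ≡ (if ⌊ durfeeBase D + j ≤? n ⌋ then rowPairs m D (n ∸ durfeeBase D) j else 0)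
    per-part D j = trans (sum-if ⌊ durfeeBase D + j ≤? n ⌋ (hasRank m) _)
      (cong (λ v → if ⌊ durfeeBase D + j ≤? n ⌋ then v else 0) (rowPairs-symbols m D j (n ∸ durfeeBase D)))

  symbolValue : (m D R : ℕ) → ℕ
  symbolValue m D R = ∑[ Y < suc R ] (p≤ (suc D) Y * shift (Y + Y + m) (spread (p≤ D)) R)

  ∑-rowPairs : ∀ m D R → D ≡ 0 ⊎ R ≤ 3 * m → ∑[ j < suc R ] rowPairs m D R j ≡ symbolValue m D R
  ∑-rowPairs m D R bound = begin
    ∑[ j < suc R ] rowPairs m D R j              ≡⟨ ∑-reverse (suc R) (rowPairs m D R) ⟩
    ∑[ j < suc R ] rowPairs m D R (R ∸ j)        ≡⟨ ∑-cong-< (suc R) (λ j j<1+R → bottom-weighted j (≤-pred j<1+R)) ⟩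
    ∑[ j < suc R ] oddRowsWeighted D j ψ         ≡⟨ ∑-oddRowsWeighted (suc R) D ψ vanish (suc R) ≤-refl ⟩
    symbolValue m D R                            ∎
    where
    ψ : ℕ → ℕ
    ψ z = shift (z + m) (spread (p≤ D)) R
    vanish : ∀ z → suc R ≤ z → ψ z ≡ 0
    vanish z R<z = shift-below (z + m) (spread (p≤ D)) R (≤-trans R<z (m≤m+n z m))
    top-bound : ∀ j t → D ≡ 0 ⊎ R ∸ j ≤ 3 * (t + m)
    top-bound j t = Sum.map₂ (λ R≤3m → ≤-trans (m∸n≤m R j) (≤-trans R≤3m (*-monoʳ-≤ 3 (m≤n+m m t)))) bound
    bottom-weighted : ∀ j → j ≤ R → rowPairs m D R (R ∸ j) ≡ oddRowsWeighted D j ψ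
    bottom-weighted j j≤R = begin
      oddRowSum D (R ∸ (R ∸ j)) (λ bot → oddRowsOfLength D (R ∸ j) (length bot + m))
        ≡⟨ cong (λ r → oddRowSum D r (λ bot → oddRowsOfLength D (R ∸ j) (length bot + m))) (m∸[m∸n]≡n j≤R) ⟩
      oddRowSum D j (λ bot → oddRowsOfLength D (R ∸ j) (length bot + m))
        ≡⟨ rowSum-cong oddᵇ (suc (D + D)) j (λ bot → begin
             oddRowsOfLength D (R ∸ j) (length bot + m)      ≡⟨ oddRowsOfLength-spread (length bot + m) D (R ∸ j) (top-bound j (length bot)) ⟩
             shift (length bot + m) (spread (p≤ D)) (R ∸ j)  ≡⟨ shift-∸ (length bot + m) j R (spread (p≤ D)) j≤R ⟩
             shift (j + (length bot + m)) (spread (p≤ D)) R  ≡⟨ cong (λ k → shift k (spread (p≤ D)) R) (+-assoc j (length bot) m) ⟨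
             ψ (j + length bot)                              ∎) ⟩
      oddRowsWeighted D j ψ ∎

  symbolsWithDurfee-< : ∀ m n D → n < durfeeBase D → symbolsWithDurfee m n D ≡ 0
  symbolsWithDurfee-< m n D n<base = ∑-zero (suc n) (λ j _ →
    if-no (durfeeBase D + j ≤? n) (rowPairs m D (n ∸ durfeeBase D) j)
          (λ base+j≤n → <⇒≱ n<base (≤-trans (m≤m+n (durfeeBase D) j) base+j≤n)))

  symbolsWithDurfee-≥ : ∀ m n D → durfeeBase D ≤ n → D ≡ 0 ⊎ n ∸ durfeeBase D ≤ 3 * m →
    symbolsWithDurfee m n D ≡ symbolValue m D (n ∸ durfeeBase D)
  symbolsWithDurfee-≥ m n D base≤n bound = begin
    symbolsWithDurfee m n D
      ≡⟨ ∑-truncate (suc R) (suc n) _ (s≤s (m∸n≤m n (durfeeBase D)))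
           (λ j R<j _ → if-no (durfeeBase D + j ≤? n) (rowPairs m D R j) (λ base+j≤n → <⇒≱ R<j
              (+-cancelˡ-≤ (durfeeBase D) j R (≤-trans base+j≤n (≤-reflexive (sym (m+[n∸m]≡n base≤n))))))) ⟩
    ∑[ j < suc R ] (if ⌊ durfeeBase D + j ≤? n ⌋ then rowPairs m D R j else 0)
      ≡⟨ ∑-cong-< (suc R) (λ j j<1+R → if-yes (durfeeBase D + j ≤? n) (rowPairs m D R j)
           (≤-trans (+-monoʳ-≤ (durfeeBase D) (≤-pred j<1+R)) (≤-reflexive (m+[n∸m]≡n base≤n)))) ⟩
    ∑[ j < suc R ] rowPairs m D R j
      ≡⟨ ∑-rowPairs m D R bound ⟩
    symbolValue m D R ∎
    where
    R = n ∸ durfeeBase D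

  symbolValue-small : ∀ m D R → R < m → symbolValue m D R ≡ 0
  symbolValue-small m D R R<m = ∑-zero (suc R) (λ Y _ →
    trans (cong (p≤ (suc D) Y *_) (shift-below (Y + Y + m) (spread (p≤ D)) R (≤-trans R<m (m≤n+m m (Y + Y)))))
          (*-zeroʳ (p≤ (suc D) Y)))

  symbolValue-even : ∀ m D K → symbolValue m D (K + K + m) ≡ (p≤ D ⋆ p≤ (suc D)) K
  symbolValue-even m D K = begin
    symbolValue m D (K + K + m)
      ≡⟨ ∑-truncate (suc K) (suc (K + K + m)) _ (s≤s (≤-trans (m≤m+n K K) (m≤m+n (K + K) m)))
           (λ Y K<Y _ → trans (cong (p≤ (suc D) Y *_) (shift-below (Y + Y + m) (spread (p≤ D)) (K + K + m)
                                  (+-monoˡ-< m (+-mono-< K<Y K<Y))))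
                              (*-zeroʳ (p≤ (suc D) Y))) ⟩
    ∑[ Y < suc K ] (p≤ (suc D) Y * shift (Y + Y + m) (spread (p≤ D)) (K + K + m))
      ≡⟨ ∑-cong-< (suc K) (λ Y Y<1+K → cong (p≤ (suc D) Y *_) (complement Y (≤-pred Y<1+K))) ⟩
    (p≤ (suc D) ⋆ p≤ D) K
      ≡⟨ ⋆-comm (p≤ (suc D)) (p≤ D) K ⟩
    (p≤ D ⋆ p≤ (suc D)) K ∎
    where
    rearrange : ∀ m Y u → (Y + u) + (Y + u) + m ≡ (Y + Y + m) + (u + u)
    rearrange = solve-∀
    complement : ∀ Y → Y ≤ K → shift (Y + Y + m) (spread (p≤ D)) (K + K + m) ≡ p≤ D (K ∸ Y)
    complement Y Y≤K = begin
      shift (Y + Y + m) (spread (p≤ D)) (K + K + m)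
        ≡⟨ cong (λ k → shift (Y + Y + m) (spread (p≤ D)) (k + k + m)) (m+[n∸m]≡n Y≤K) ⟨
      shift (Y + Y + m) (spread (p≤ D)) ((Y + (K ∸ Y)) + (Y + (K ∸ Y)) + m)
        ≡⟨ cong (shift (Y + Y + m) (spread (p≤ D))) (rearrange m Y (K ∸ Y)) ⟩
      shift (Y + Y + m) (spread (p≤ D)) ((Y + Y + m) + ((K ∸ Y) + (K ∸ Y)))
        ≡⟨ shift-at (Y + Y + m) (spread (p≤ D)) _ ⟩
      spread (p≤ D) ((K ∸ Y) + (K ∸ Y))
        ≡⟨ spread-double (K ∸ Y) (p≤ D) ⟩
      p≤ D (K ∸ Y) ∎

  durfeeBase≡ : ∀ D → durfeeBase D ≡ suc (D * (D + 1) + D * (D + 1))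
  durfeeBase≡ = polynomial
    where
    polynomial : ∀ D → 2 * D * D + 2 * D + 1 ≡ suc (D * (D + 1) + D * (D + 1))
    polynomial = solve-∀

  symbolsWithDurfee-rectangle : ∀ m D u → D ≡ 0 ⊎ u ≤ m →
    symbolsWithDurfee m (suc ((D * (D + 1) + u) + (D * (D + 1) + u) + m)) D ≡ (p≤ D ⋆ p≤ (suc D)) u
  symbolsWithDurfee-rectangle m D u bound = begin
    symbolsWithDurfee m n D
      ≡⟨ symbolsWithDurfee-≥ m n D base≤n (Sum.map₂ (λ u≤m → subst (_≤ 3 * m) (sym rest≡) (weight≤3m u≤m)) bound) ⟩
    symbolValue m D (n ∸ durfeeBase D)
      ≡⟨ cong (symbolValue m D) rest≡ ⟩
    symbolValue m D (u + u + m)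
      ≡⟨ symbolValue-even m D u ⟩
    (p≤ D ⋆ p≤ (suc D)) u ∎
    where
    a = D * (D + 1)
    n = suc ((a + u) + (a + u) + m)
    rearrange : ∀ m a u → (a + u) + (a + u) + m ≡ (a + a) + (u + u + m)
    rearrange = solve-∀
    rest≡ : n ∸ durfeeBase D ≡ u + u + m
    rest≡ = trans (cong (n ∸_) (durfeeBase≡ D)) (trans (cong (_∸ (a + a)) (rearrange m a u)) (m+n∸m≡n (a + a) _))
    base≤n : durfeeBase D ≤ n
    base≤n = subst (_≤ n) (sym (durfeeBase≡ D)) (s≤s (subst (a + a ≤_) (sym (rearrange m a u)) (m≤m+n (a + a) _)))
    weight≤3m : u ≤ m → u + u + m ≤ 3 * m
    weight≤3m u≤m = ≤-trans (+-monoˡ-≤ m (+-mono-≤ u≤m u≤m)) (≤-reflexive (thrice m))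
      where
      thrice : ∀ m → m + m + m ≡ 3 * m
      thrice = solve-∀

  symbolsWithDurfee-odd : ∀ m k D → k ≤ m + 2 →
    symbolsWithDurfee m (suc (k + k + m)) D ≡ shift (D * (D + 1)) (p≤ D ⋆ p≤ (suc D)) k
  symbolsWithDurfee-odd m k D k≤m+2 with D * (D + 1) ≤? k
  ... | yes a≤k = begin
    symbolsWithDurfee m (suc (k + k + m)) D
      ≡⟨ cong (λ k → symbolsWithDurfee m (suc (k + k + m)) D) (m+[n∸m]≡n a≤k) ⟨
    symbolsWithDurfee m (suc ((a + (k ∸ a)) + (a + (k ∸ a)) + m)) D
      ≡⟨ symbolsWithDurfee-rectangle m D (k ∸ a) (excess D) ⟩
    (p≤ D ⋆ p≤ (suc D)) (k ∸ a)
      ≡⟨ shift-≥ a (p≤ D ⋆ p≤ (suc D)) a≤k ⟨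
    shift a (p≤ D ⋆ p≤ (suc D)) k ∎
    where
    a = D * (D + 1)
    excess : ∀ D → D ≡ 0 ⊎ k ∸ D * (D + 1) ≤ m
    excess zero    = inj₁ refl
    excess (suc D) = inj₂ (≤-trans (∸-monoʳ-≤ k (≤-trans (m≤m+n 2 D) (rectangle-area D)))
                                   (m≤n+o⇒m∸n≤o k 2 (subst (k ≤_) (+-comm m 2) k≤m+2)))
  ... | no a≰k = trans (small (durfeeBase D ≤? n)) (sym (shift-below a _ k (≰⇒> a≰k)))
    where
    a = D * (D + 1)
    n = suc (k + k + m)
    small : Dec (durfeeBase D ≤ n) → symbolsWithDurfee m n D ≡ 0
    small (no base≰n)  = symbolsWithDurfee-< m n D (≰⇒> base≰n)
    small (yes base≤n) = trans (symbolsWithDurfee-≥ m n D base≤n (inj₂ (≤-trans (<⇒≤ rest<m) (m≤n*m m 3))))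
                               (symbolValue-small m D (n ∸ durfeeBase D) rest<m)
      where
      2a≤2k+m : a + a ≤ k + k + m
      2a≤2k+m = ≤-pred (subst (_≤ n) (durfeeBase≡ D) base≤n)
      rest<m : n ∸ durfeeBase D < m
      rest<m = subst (_< m) (cong (n ∸_) (sym (durfeeBase≡ D)))
        (subst (_≤ m) (+-∸-assoc 1 2a≤2k+m)
          (m≤n+o⇒m∸n≤o (suc (k + k + m)) (a + a) (+-monoˡ-< m (+-mono-< (≰⇒> a≰k) (≰⇒> a≰k)))))

  symbolsWithDurfee-short : ∀ m n D → n ≤ m → symbolsWithDurfee m n D ≡ 0
  symbolsWithDurfee-short m n D n≤m with durfeeBase D ≤? n
  ... | no base≰n  = symbolsWithDurfee-< m n D (≰⇒> base≰n)
  ... | yes base≤n = trans (symbolsWithDurfee-≥ m n D base≤n (inj₂ (≤-trans (<⇒≤ rest<m) (m≤n*m m 3))))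
                           (symbolValue-small m D (n ∸ durfeeBase D) rest<m)
    where
    rest<m : n ∸ durfeeBase D < m
    rest<m = ≤-trans (∸-monoʳ-< {o = 0} (subst (0 <_) (sym (durfeeBase≡ D)) z<s) base≤n) n≤m

  N⁰-odd : ∀ m k → k ≤ m + 2 → N⁰ (ℤ.+ m) (suc (k + k + m)) ≡ p k
  N⁰-odd m k k≤m+2 = begin
    N⁰ (ℤ.+ m) n                                                   ≡⟨ N⁰-split m n ⟩
    ∑[ D < suc n ] symbolsWithDurfee m n D                         ≡⟨ ∑-cong (suc n) (λ D → symbolsWithDurfee-odd m k D k≤m+2) ⟩
    ∑[ D < suc n ] shift (D * (D + 1)) (p≤ D ⋆ p≤ (suc D)) k       ≡⟨ p≡∑-rectangles k n k≤n ⟨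
    p k                                                            ∎
    where
    n = suc (k + k + m)
    k≤n : k ≤ n
    k≤n = ≤-trans (m≤m+n k k) (≤-trans (m≤m+n (k + k) m) (n≤1+n _))

  N⁰-short : ∀ m n → n ≤ m → N⁰ (ℤ.+ m) n ≡ 0
  N⁰-short m n n≤m = trans (N⁰-split m n) (∑-zero (suc n) (λ D _ → symbolsWithDurfee-short m n D n≤m))

  pℤ-negative-half : ∀ c → pℤ (-[1+ c ] ℤ./ ℤ.+ 2) ≡ 0
  pℤ-negative-half c with -[1+ c ] ℤ./ ℤ.+ 2 | ℤDM.a≡a%n+[a/n]*n -[1+ c ] (ℤ.+ 2)
  ... | -[1+ _ ] | _ = refl
  ... | ℤ.+ q    | division with trans division (cong (ℤ._+_ (ℤ.+ (-[1+ c ] ℤ.% ℤ.+ 2))) (sym (ℤP.pos-* q 2)))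
  ... | ()

  pℤ-double-half : ∀ q → pℤ (ℤ.+ (q * 2) ℤ./ ℤ.+ 2) ≡ p q
  pℤ-double-half q = cong pℤ (trans (ℤDM.div-pos-is-/ℕ (ℤ.+ (q * 2)) 2) (cong ℤ.+_ (m*n/n≡m q 2)))

  n-m-1≡⊖ : ∀ m n → ℤ.+ n ℤ.- ℤ.+ m ℤ.- ℤ.+ 1 ≡ n ℤ.⊖ suc m
  n-m-1≡⊖ m n = begin
    ℤ.+ n ℤ.- ℤ.+ m ℤ.- ℤ.+ 1   ≡⟨ minus-minus (ℤ.+ n) (ℤ.+ m) ⟩
    ℤ.+ n ℤ.- ℤ.+ (suc m)       ≡⟨ ℤP.m-n≡m⊖n n (suc m) ⟩
    n ℤ.⊖ suc m                 ∎
    where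
    minus-minus : ∀ (i j : ℤ.ℤ) → i ℤ.- j ℤ.- ℤ.+ 1 ≡ i ℤ.- (ℤ.+ 1 ℤ.+ j)
    minus-minus = solveℤ-∀

  half-≤ : ∀ q k → q + q ≤ k + k → q ≤ k
  half-≤ q k 2q≤2k = ≮⇒≥ (λ k<q → <⇒≱ (+-mono-< k<q k<q) 2q≤2k)

  N⁰-nonnegative-rank : ∀ m n → n ≤ 3 * m + 5 → 2 ∣ ℤ.∣ ℤ.+ n ℤ.- ℤ.+ m ℤ.- ℤ.+ 1 ∣ →
    N⁰ (ℤ.+ m) n ≡ pℤ ((ℤ.+ n ℤ.- ℤ.+ m ℤ.- ℤ.+ 1) ℤ./ ℤ.+ 2)
  N⁰-nonnegative-rank m n n≤3m+5 even rewrite n-m-1≡⊖ m n with suc m ≤? n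
  ... | no m≮n = begin
    N⁰ (ℤ.+ m) n                         ≡⟨ N⁰-short m n n≤m ⟩
    0                                    ≡⟨ pℤ-negative-half (m ∸ n) ⟨
    pℤ (-[1+ m ∸ n ] ℤ./ ℤ.+ 2)          ≡⟨ cong (λ k → pℤ (k ℤ./ ℤ.+ 2)) negative ⟨
    pℤ ((n ℤ.⊖ suc m) ℤ./ ℤ.+ 2)          ∎
    where
    n≤m = ≤-pred (≰⇒> m≮n)
    negative : n ℤ.⊖ suc m ≡ -[1+ m ∸ n ]
    negative = trans (ℤP.⊖-< (s≤s n≤m)) (cong (λ k → ℤ.- ℤ.+ k) (+-∸-assoc 1 n≤m))
  ... | yes m<n with subst (2 ∣_) (cong ℤ.∣_∣ (ℤP.⊖-≥ m<n)) even
  ...   | divides q n∸1+m≡q*2 = begin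
    N⁰ (ℤ.+ m) n                         ≡⟨ cong (N⁰ (ℤ.+ m)) n≡ ⟩
    N⁰ (ℤ.+ m) (suc (q + q + m))         ≡⟨ N⁰-odd m q q≤m+2 ⟩
    p q                                  ≡⟨ pℤ-double-half q ⟨
    pℤ (ℤ.+ (q * 2) ℤ./ ℤ.+ 2)           ≡⟨ cong (λ k → pℤ (k ℤ./ ℤ.+ 2)) nonnegative ⟨
    pℤ ((n ℤ.⊖ suc m) ℤ./ ℤ.+ 2)          ∎
    where
    nonnegative : n ℤ.⊖ suc m ≡ ℤ.+ (q * 2)
    nonnegative = trans (ℤP.⊖-≥ m<n) (cong ℤ.+_ n∸1+m≡q*2)
    rearrange : ∀ m q → suc m + q * 2 ≡ suc (q + q + m)
    rearrange = solve-∀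
    n≡ : n ≡ suc (q + q + m)
    n≡ = trans (sym (m+[n∸m]≡n m<n)) (trans (cong (suc m +_) n∸1+m≡q*2) (rearrange m q))
    shift-part : ∀ m q → suc (q + q + m) ≡ q + q + (m + 1)
    shift-part = solve-∀
    bound-part : ∀ m → 3 * m + 5 ≡ m + 2 + (m + 2) + (m + 1)
    bound-part = solve-∀
    q≤m+2 : q ≤ m + 2
    q≤m+2 = half-≤ q (m + 2) (+-cancelʳ-≤ (m + 1) (q + q) (m + 2 + (m + 2))
      (subst₂ _≤_ (shift-part m q) (bound-part m) (subst (_≤ 3 * m + 5) n≡ n≤3m+5)))

open Counting using (N⁰-nonnegative-rank)

open import Data.Nat as ℕ using (ℕ; zero; suc; s≤s)
open import Data.Nat.Divisibility using (∣1⇒≡1)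
import Data.Nat.Properties as ℕP
open import Data.Nat.Tactic.RingSolver using (solve-∀)
open import Data.Integer using (ℤ; +_; _+_; _-_; _*_; _≤_; -_; -[1+_]; +≤+)
open import Data.Integer.Divisibility using (_∣_)
open import Data.Integer.DivMod using (_/_)
import Data.Integer.Properties as ℤP
open import Relation.Binary.PropositionalEquality using (_≡_; refl; sym; trans; cong; subst)

3m+5-nonnegative : ∀ m → + 3 * + m + + 5 ≡ + (3 ℕ.* m ℕ.+ 5)
3m+5-nonnegative m = sym (trans (ℤP.pos-+ (3 ℕ.* m) 5) (cong (_+ + 5) (ℤP.pos-* 3 m)))

3m+5-below-minus-two : ∀ x → + 3 * -[1+ suc x ] + + 5 ≡ -[1+ 3 ℕ.* x ]
3m+5-below-minus-two x = trans (ℤP.⊖-< (ℕP.≤-trans (ℕP.m≤m+n 6 (3 ℕ.* x)) (ℕP.≤-reflexive (sym (6+3x x)))))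
                               (cong (λ k → - + k) (trans (cong (ℕ._∸ 5) (6+3x x)) (ℕP.m+n∸m≡n 5 (suc (3 ℕ.* x)))))
  where
  6+3x : ∀ x → 3 ℕ.* suc (suc x) ≡ 5 ℕ.+ suc (3 ℕ.* x)
  6+3x = solve-∀

corollary1p4 : (m : ℤ) (n : ℕ) → + 1 ≤ + n → + n ≤ + 3 * m + + 5
    → + 2 ∣ (+ n - m - + 1)
    → N⁰ m n ≡ pℤ ((+ n - m - + 1) / + 2)
corollary1p4 (+ m) n _ n≤3m+5 even =
  N⁰-nonnegative-rank m n (ℤP.drop‿+≤+ (subst (+ n ≤_) (3m+5-nonnegative m) n≤3m+5)) even
corollary1p4 -[1+ 0 ] zero (+≤+ ()) _ _
corollary1p4 -[1+ 0 ] 1 _ _ even with ∣1⇒≡1 even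
... | ()
corollary1p4 -[1+ 0 ] 2 _ _ _ = refl
corollary1p4 -[1+ 0 ] (suc (suc (suc n))) _ (+≤+ (s≤s (s≤s ()))) _
corollary1p4 -[1+ suc x ] n _ n≤3m+5 _ with subst (+ n ≤_) (3m+5-below-minus-two x) n≤3m+5
... | ()
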